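{- For any graph $G$ on $K$ vertices and any $m$ with $3\le m\le K$, if the average degree of $G$ is at least $m$, then $G$ contains a connected-matching on at least $m$ vertices.
   Context: A matching is a set of pairwise vertex-disjoint edges; a connected-matching is a matching all of whose edges lie in a single connected component of $G$. -}

module Defs where

open import Data.Nat using (ℕ; zero; suc; _+_; _*_; _≤_)
open import Data.Bool using (Bool; true; false; if_then_else_)
open import Data.Fin using (Fin)
open import Data.Nat.ListAction using (sum)
open import Data.List using (List; []; _∷_; map; length; concatMap; allFin)
open import Data.List.Relation.Unary.All using (All)
open import Data.List.Relation.Unary.Unique.Propositional using (Unique)
open import Data.Product using (Σ; _×_; _,_; ∃-syntax)
open import Relation.Binary.PropositionalEquality using (_≡_)

record Graph (K : ℕ) : Set where
  field
    adj     : Fin K → Fin K → Bool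
    sym     : ∀ u v → adj u v ≡ adj v u
    irrefl  : ∀ v → adj v v ≡ false

module _ {K : ℕ} (G : Graph K) where
  open Graph G

  Adj : Fin K → Fin K → Set
  Adj u v = adj u v ≡ true

  degree : Fin K → ℕ
  degree v = sum (map (λ u → if adj v u then 1 else 0) (allFin K))

  degreeSum : ℕ
  degreeSum = sum (map degree (allFin K))

  -- average degree ≥ m, i.e. (degreeSum / K) ≥ m, written without division
  AvgDegreeAtLeast : ℕ → Set
  AvgDegreeAtLeast m = m * K ≤ degreeSum

  data Reachable : Fin K → Fin K → Set where
    here : ∀ {u} → Reachable u u
    step : ∀ {u v w} → Adj u v → Reachable v w → Reachable u w

  endpoints : List (Fin K × Fin K) → List (Fin K)
  endpoints = concatMap (λ { (u , v) → u ∷ v ∷ [] })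

  IsMatching : List (Fin K × Fin K) → Set
  IsMatching M = All (λ { (u , v) → Adj u v }) M × Unique (endpoints M)

  IsConnectedMatching : List (Fin K × Fin K) → Set
  IsConnectedMatching M =
    IsMatching M × ∃[ r ] All (λ { (u , v) → Reachable r u × Reachable r v }) M

  matchingVertices : List (Fin K × Fin K) → ℕ
  matchingVertices M = length (endpoints M)

-- Choose a connected component C whose average degree is still at least m: summing |C| and
-- the degree sum vol C over all components gives K and the total degree sum, so some
-- component is as dense as the whole graph.  Inside C grow a matching covering N vertices:
-- add an edge between two unmatched vertices of C, or replace an edge xy of the matching by
-- ux and wy for distinct unmatched u, w.  When neither move applies, count degrees in C:
-- unmatched vertices have only matched neighbours, a matched vertex has at most N - 1
-- matched neighbours, and the two ends of a matching edge have at most F + 1 of the F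
-- unmatched vertices as neighbours together.  Double counting the edges between matched
-- and unmatched vertices gives  vol C ≤ N (N + F) = N |C|,  hence N ≥ m.

module Submission where

open import Defs
open import Data.Bool using (Bool; true; false; if_then_else_; _∧_; _∨_; not)
open import Data.Bool.Properties using () renaming (_≟_ to _≟ᵇ_)
open import Data.Empty using (⊥-elim)
open import Data.Fin using (Fin; zero; suc; _≟_)
open import Data.Fin.Properties using (any?; suc-injective)
open import Data.List using (List; []; _∷_; _++_; map; length; tabulate; allFin)
open import Data.List.Properties using (map-tabulate; tabulate-cong)
open import Data.List.Relation.Unary.All as All using (All; []; _∷_)
open import Data.List.Relation.Unary.All.Properties using (All¬⇒¬Any; ¬Any⇒All¬; ++⁺; ++⁻)
open import Data.List.Relation.Unary.AllPairs using ([]; _∷_)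
open import Data.List.Relation.Unary.Unique.Propositional using (Unique)
open import Data.List.Membership.Propositional using (_∈_; _∉_; find)
open import Data.List.Membership.Propositional.Properties using (∈-∃++)
open import Data.List.Relation.Binary.Permutation.Propositional
  using (_↭_; ↭-refl; ↭-prep; ↭-swap; ↭-trans; ↭-sym; ↭⇒↭ₛ)
open import Data.List.Relation.Binary.Permutation.Propositional.Properties using (shifts; ↭-length)
open import Data.List.Relation.Unary.Any as Any using (here; there)
open import Data.Nat using (ℕ; zero; suc; _+_; _*_; _≤_; _<_; z≤n; s≤s; _≤?_; _<?_; >-nonZero)
open import Data.Nat.ListAction using (sum)
open import Data.Nat.Properties
  using (≤-refl; ≤-reflexive; ≤-trans; <-≤-trans; +-mono-≤; +-mono-<-≤; +-mono-≤-<;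
         m≤m+n; +-identityʳ; *-zeroʳ; *-distribˡ-+; m+n≡0⇒m≡0; m+n≡0⇒n≡0;
         n≤0⇒n≡0; ≮⇒≥; ≰⇒>; <⇒≤; <⇒≱; ≤-pred; +-suc; *-identityʳ; *-cancelʳ-≤;
         +-monoʳ-≤; +-comm; +-cancelʳ-≤; +-assoc; *-distribʳ-+;
         module ≤-Reasoning)
open import Data.Nat.Tactic.RingSolver using (solve-∀)
open import Data.Product using (Σ; _×_; _,_; ∃-syntax; proj₁; proj₂)
open import Data.Sum using (_⊎_; inj₁; inj₂)
open import Function using (_∘_)
open import Relation.Binary.PropositionalEquality
  using (_≡_; _≢_; refl; sym; trans; cong; cong₂; subst; subst₂; setoid; module ≡-Reasoning)
open import Relation.Nullary using (¬_; Dec; yes; no; does; contradiction)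
open import Relation.Nullary.Decidable using (dec-true; dec-false; _×-dec_; ¬?; decidable-stable)

dec-true⁻¹ : ∀ {a} {A : Set a} (a? : Dec A) → does a? ≡ true → A
dec-true⁻¹ (yes a) _ = a
dec-true⁻¹ (no _) ()

dec-false⁻¹ : ∀ {a} {A : Set a} (a? : Dec A) → does a? ≡ false → ¬ A
dec-false⁻¹ (yes _) ()
dec-false⁻¹ (no ¬a) _ = ¬a

∧-true : ∀ {a b} → a ∧ b ≡ true → a ≡ true × b ≡ true
∧-true {true} {true} _ = refl , refl

-- Boolean weights and sums over Fin n

infixr 7 _⊙_

_⊙_ : Bool → ℕ → ℕ
b ⊙ x = if b then x else 0

⊙-cong : ∀ b {x y} → (b ≡ true → x ≡ y) → b ⊙ x ≡ b ⊙ y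
⊙-cong true x≡y = x≡y refl
⊙-cong false _ = refl

⊙-mono : ∀ b {x y} → (b ≡ true → x ≤ y) → b ⊙ x ≤ b ⊙ y
⊙-mono true x≤y = x≤y refl
⊙-mono false _ = z≤n

⊙-comm : ∀ a b x → a ⊙ b ⊙ x ≡ b ⊙ a ⊙ x
⊙-comm true b x = refl
⊙-comm false true x = refl
⊙-comm false false x = refl

⊙-distrib-+ : ∀ b x y → b ⊙ (x + y) ≡ b ⊙ x + b ⊙ y
⊙-distrib-+ true x y = refl
⊙-distrib-+ false x y = refl

⊙-* : ∀ b k → b ⊙ k ≡ k * (b ⊙ 1)
⊙-* true k = sym (*-identityʳ k)
⊙-* false k = sym (*-zeroʳ k)

⊙1≤1 : ∀ b → b ⊙ 1 ≤ 1
⊙1≤1 true = ≤-refl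
⊙1≤1 false = z≤n

⊙1≡0 : ∀ b x → b ⊙ 1 ≡ 0 → b ⊙ x ≡ 0
⊙1≡0 false x _ = refl

⊙-implied : ∀ b s → (b ≡ true → s ≡ true) → b ⊙ 1 ≡ s ⊙ b ⊙ 1
⊙-implied true s b⇒s rewrite b⇒s refl = refl
⊙-implied false true _ = refl
⊙-implied false false _ = refl

⊙-split : ∀ s m y → (m ≡ true → s ≡ true) → s ⊙ y ≡ m ⊙ y + (s ∧ not m) ⊙ y
⊙-split s true y m⇒s rewrite m⇒s refl = sym (+-identityʳ y)
⊙-split true false y _ = refl
⊙-split false false y _ = refl

∨-⊙ : ∀ a b y → (a ≡ true → b ≡ false) → (a ∨ b) ⊙ y ≡ a ⊙ y + b ⊙ y
∨-⊙ true b y disjoint rewrite disjoint refl = sym (+-identityʳ y)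
∨-⊙ false b y _ = refl

∑ : ∀ {n} → (Fin n → ℕ) → ℕ
∑ f = sum (tabulate f)

∑-cong : ∀ {n} {f g : Fin n → ℕ} → (∀ i → f i ≡ g i) → ∑ f ≡ ∑ g
∑-cong f≗g = cong sum (tabulate-cong f≗g)

∑-zero : ∀ n → ∑ {n} (λ _ → 0) ≡ 0
∑-zero zero = refl
∑-zero (suc n) = ∑-zero n

∑-1 : ∀ n → ∑ {n} (λ _ → 1) ≡ n
∑-1 zero = refl
∑-1 (suc n) = cong suc (∑-1 n)

∑-allFin : ∀ {n} (f : Fin n → ℕ) → sum (map f (allFin n)) ≡ ∑ f
∑-allFin f = cong sum (map-tabulate (λ i → i) f)

∑-mono-≤ : ∀ {n} {f g : Fin n → ℕ} → (∀ i → f i ≤ g i) → ∑ f ≤ ∑ g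
∑-mono-≤ {zero} f≤g = z≤n
∑-mono-≤ {suc n} f≤g = +-mono-≤ (f≤g zero) (∑-mono-≤ (f≤g ∘ suc))

∑-mono-< : ∀ {n} {f g : Fin n → ℕ} (x : Fin n) →
  (∀ i → f i ≤ g i) → f x < g x → ∑ f < ∑ g
∑-mono-< zero f≤g fx<gx = +-mono-<-≤ fx<gx (∑-mono-≤ (f≤g ∘ suc))
∑-mono-< (suc x) f≤g fx<gx = +-mono-≤-< (f≤g zero) (∑-mono-< x (f≤g ∘ suc) fx<gx)

∑-distrib-+ : ∀ {n} (f g : Fin n → ℕ) → ∑ (λ i → f i + g i) ≡ ∑ f + ∑ g
∑-distrib-+ {zero} f g = refl
∑-distrib-+ {suc n} f g = trans
  (cong (f zero + g zero +_) (∑-distrib-+ (f ∘ suc) (g ∘ suc)))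
  (interchange (f zero) (g zero) (∑ (f ∘ suc)) (∑ (g ∘ suc)))
  where
  interchange : ∀ a b c d → (a + b) + (c + d) ≡ (a + c) + (b + d)
  interchange = solve-∀

∑-distribˡ-* : ∀ {n} k (f : Fin n → ℕ) → ∑ (λ i → k * f i) ≡ k * ∑ f
∑-distribˡ-* {zero} k f = sym (*-zeroʳ k)
∑-distribˡ-* {suc n} k f = trans (cong (k * f zero +_) (∑-distribˡ-* k (f ∘ suc)))
  (sym (*-distribˡ-+ k (f zero) (∑ (f ∘ suc))))

∑-swap : ∀ {n p} (f : Fin n → Fin p → ℕ) →
  ∑ (λ i → ∑ (λ j → f i j)) ≡ ∑ (λ j → ∑ (λ i → f i j))
∑-swap {zero} {p} f = sym (∑-zero p)
∑-swap {suc n} f = trans (cong (∑ (f zero) +_) (∑-swap (f ∘ suc)))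
  (sym (∑-distrib-+ (f zero) (λ j → ∑ (λ i → f (suc i) j))))

⊙-∑ : ∀ {n} b (f : Fin n → ℕ) → b ⊙ ∑ f ≡ ∑ (λ i → b ⊙ f i)
⊙-∑ true f = refl
⊙-∑ {n} false f = sym (∑-zero n)

∑⊙∑-comm : ∀ {n} (p q : Fin n → Bool) (r : Fin n → Fin n → ℕ) →
  (∀ i j → r i j ≡ r j i) →
  ∑ (λ i → p i ⊙ ∑ (λ j → q j ⊙ r i j)) ≡ ∑ (λ i → q i ⊙ ∑ (λ j → p j ⊙ r i j))
∑⊙∑-comm p q r r-sym = begin
  ∑ (λ i → p i ⊙ ∑ (λ j → q j ⊙ r i j))
    ≡⟨ ∑-cong (λ i → ⊙-∑ (p i) (λ j → q j ⊙ r i j)) ⟩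
  ∑ (λ i → ∑ (λ j → p i ⊙ q j ⊙ r i j))
    ≡⟨ ∑-swap (λ i j → p i ⊙ q j ⊙ r i j) ⟩
  ∑ (λ j → ∑ (λ i → p i ⊙ q j ⊙ r i j))
    ≡⟨ ∑-cong (λ j → ∑-cong (λ i → reorder i j)) ⟩
  ∑ (λ j → ∑ (λ i → q j ⊙ p i ⊙ r j i))
    ≡⟨ ∑-cong (λ j → ⊙-∑ (q j) (λ i → p i ⊙ r j i)) ⟨
  ∑ (λ j → q j ⊙ ∑ (λ i → p i ⊙ r j i)) ∎
  where
  open ≡-Reasoning
  reorder : ∀ i j → p i ⊙ q j ⊙ r i j ≡ q j ⊙ p i ⊙ r j i
  reorder i j = trans (⊙-comm (p i) (q j) (r i j)) (cong (λ x → q j ⊙ p i ⊙ x) (r-sym i j))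

∑-single : ∀ {n} {f : Fin n → ℕ} (x : Fin n) →
  (∀ i → i ≢ x → f i ≡ 0) → ∑ f ≡ f x
∑-single {suc n} {f} zero f≡0 = trans
  (cong (f zero +_) (trans (∑-cong (λ i → f≡0 (suc i) λ ())) (∑-zero n)))
  (+-identityʳ (f zero))
∑-single {suc n} (suc x) f≡0 = cong₂ _+_
  (f≡0 zero λ ())
  (∑-single x (λ i i≢x → f≡0 (suc i) (i≢x ∘ suc-injective)))

∑-select : ∀ {n} (x : Fin n) (f : Fin n → ℕ) →
  ∑ (λ i → does (i ≟ x) ⊙ f i) ≡ f x
∑-select x f = trans (∑-single x off) (cong (_⊙ f x) (dec-true (x ≟ x) refl))
  where
  off : ∀ i → i ≢ x → does (i ≟ x) ⊙ f i ≡ 0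
  off i i≢x = cong (_⊙ f i) (dec-false (i ≟ x) i≢x)

∑≡0⇒≡0 : ∀ {n} (f : Fin n → ℕ) → ∑ f ≡ 0 → ∀ i → f i ≡ 0
∑≡0⇒≡0 f ∑f≡0 zero = m+n≡0⇒m≡0 (f zero) ∑f≡0
∑≡0⇒≡0 f ∑f≡0 (suc i) = ∑≡0⇒≡0 (f ∘ suc) (m+n≡0⇒n≡0 (f zero) ∑f≡0) i

∑-pos : ∀ {n} (f : Fin n → ℕ) → 0 < ∑ f → ∃[ i ] 0 < f i
∑-pos {suc n} f pos with 0 <? f zero
... | yes f₀>0 = zero , f₀>0
... | no f₀≯0
  with i , fᵢ>0 ← ∑-pos (f ∘ suc) 
      (subst (λ k → 0 < k + ∑ (f ∘ suc)) (n≤0⇒n≡0 (≮⇒≥ f₀≯0)) pos)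
  = suc i , fᵢ>0

∑-atMostOne : ∀ {n} (t : Fin n → Bool) →
  (∀ i j → t i ≡ true → t j ≡ true → i ≡ j) → ∑ (λ i → t i ⊙ 1) ≤ 1
∑-atMostOne {zero} t _ = z≤n
∑-atMostOne {suc n} t unique with t zero in t₀
... | true = ≤-reflexive (cong suc (trans (∑-cong others) (∑-zero n)))
  where
  others : ∀ i → t (suc i) ⊙ 1 ≡ 0
  others i with t (suc i) in tᵢ
  ... | true with () ← unique zero (suc i) t₀ tᵢ
  ... | false = refl
... | false =
  ∑-atMostOne (t ∘ suc) (λ i j tᵢ tⱼ → suc-injective (unique (suc i) (suc j) tᵢ tⱼ))

∑-crossing : ∀ {n} (r p q : Fin n → Bool) →
  (∀ i j → r i ≡ true → r j ≡ true → p i ≡ true → q j ≡ true → i ≡ j) →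
  ∑ (λ i → r i ⊙ p i ⊙ 1) + ∑ (λ i → r i ⊙ q i ⊙ 1) ≤
  suc (∑ (λ i → r i ⊙ 1))
∑-crossing {n} r p q crossing = begin
  ∑ (λ i → r i ⊙ p i ⊙ 1) + ∑ (λ i → r i ⊙ q i ⊙ 1)
    ≡⟨ ∑-distrib-+ (λ i → r i ⊙ p i ⊙ 1) (λ i → r i ⊙ q i ⊙ 1) ⟨
  ∑ (λ i → r i ⊙ p i ⊙ 1 + r i ⊙ q i ⊙ 1)
    ≤⟨ ∑-mono-≤ (λ i → pointwise (r i) (p i) (q i)) ⟩
  ∑ (λ i → r i ⊙ 1 + both i ⊙ 1)
    ≡⟨ ∑-distrib-+ (λ i → r i ⊙ 1) (λ i → both i ⊙ 1) ⟩
  ∑ (λ i → r i ⊙ 1) + ∑ (λ i → both i ⊙ 1)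
    ≤⟨ +-monoʳ-≤ _ (∑-atMostOne both both-unique) ⟩
  ∑ (λ i → r i ⊙ 1) + 1
    ≡⟨ +-comm _ 1 ⟩
  suc (∑ (λ i → r i ⊙ 1)) ∎
  where
  open ≤-Reasoning
  both : Fin n → Bool
  both i = r i ∧ p i ∧ q i

  pointwise : ∀ a b c → a ⊙ b ⊙ 1 + a ⊙ c ⊙ 1 ≤ a ⊙ 1 + (a ∧ b ∧ c) ⊙ 1
  pointwise false _ _ = z≤n
  pointwise true true true = ≤-refl
  pointwise true true false = ≤-refl
  pointwise true false true = ≤-refl
  pointwise true false false = z≤n

  both-unique : ∀ i j → both i ≡ true → both j ≡ true → i ≡ j
  both-unique i j bᵢ bⱼ
    with rᵢ , pqᵢ ← ∧-true bᵢ | rⱼ , pqⱼ ← ∧-true bⱼ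
    = crossing i j rᵢ rⱼ (proj₁ (∧-true pqᵢ)) (proj₂ (∧-true pqⱼ))

averaging : ∀ {n} m (f g : Fin n → ℕ) → (∀ i → g i ≡ 0 → f i ≡ 0) →
  0 < ∑ g → m * ∑ g ≤ ∑ f → ∃[ i ] (0 < g i × m * g i ≤ f i)
averaging m f g g≡0⇒f≡0 ∑g>0 dense
  with any? (λ i → (0 <? g i) ×-dec (m * g i ≤? f i))
... | yes found = found
... | no none with i , gᵢ>0 ← ∑-pos g ∑g>0 = contradiction dense (<⇒≱ ∑f<m∑g)
  where
  sparse : ∀ i → 0 < g i → f i < m * g i
  sparse i gᵢ>0 = ≰⇒> (λ le → none (i , gᵢ>0 , le))

  below : ∀ i → f i ≤ m * g i
  below i with 0 <? g i
  ... | yes gᵢ>0 = <⇒≤ (sparse i gᵢ>0)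
  ... | no gᵢ≯0 =
    ≤-reflexive (trans (g≡0⇒f≡0 i gᵢ≡0) (sym (trans (cong (m *_) gᵢ≡0) (*-zeroʳ m))))
    where
    gᵢ≡0 : g i ≡ 0
    gᵢ≡0 = n≤0⇒n≡0 (≮⇒≥ gᵢ≯0)

  ∑f<m∑g : ∑ f < m * ∑ g
  ∑f<m∑g =
    <-≤-trans (∑-mono-< i below (sparse i gᵢ>0)) (≤-reflexive (∑-distribˡ-* m g))

module _ {n : ℕ} where
  open import Data.List.Membership.DecPropositional (_≟_ {n}) using (_∈?_)

  _∈ᵇ_ : Fin n → List (Fin n) → Bool
  i ∈ᵇ L = does (i ∈? L)

  ∈ᵇ⇒∈ : ∀ {i L} → i ∈ᵇ L ≡ true → i ∈ L
  ∈ᵇ⇒∈ {i} {L} = dec-true⁻¹ (i ∈? L)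

  ∉⇒∈ᵇ : ∀ {i L} → i ∉ L → i ∈ᵇ L ≡ false
  ∉⇒∈ᵇ {i} {L} = dec-false (i ∈? L)

  ∈ᵇ⇒∉ : ∀ {i L} → i ∈ᵇ L ≡ false → i ∉ L
  ∈ᵇ⇒∉ {i} {L} = dec-false⁻¹ (i ∈? L)

  ∑-∈ᵇ : (g : Fin n → ℕ) (L : List (Fin n)) → Unique L →
    ∑ (λ i → (i ∈ᵇ L) ⊙ g i) ≡ sum (map g L)
  ∑-∈ᵇ g [] [] = ∑-zero n
  ∑-∈ᵇ g (x ∷ L) (x≢L ∷ uniq) = trans
    (∑-cong (λ i → ∨-⊙ (does (i ≟ x)) (i ∈ᵇ L) (g i) (λ i≟x → ∉⇒∈ᵇ (x∉L i≟x))))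
    (trans (∑-distrib-+ (λ i → does (i ≟ x) ⊙ g i) (λ i → (i ∈ᵇ L) ⊙ g i))
           (cong₂ _+_ (∑-select x g) (∑-∈ᵇ g L uniq)))
    where
    x∉L : ∀ {i} → does (i ≟ x) ≡ true → i ∉ L
    x∉L {i} i≟x rewrite dec-true⁻¹ (i ≟ x) i≟x = All¬⇒¬Any x≢L

sum-map-1 : ∀ {a} {A : Set a} (L : List A) → sum (map (λ _ → 1) L) ≡ length L
sum-map-1 [] = refl
sum-map-1 (_ ∷ L) = cong suc (sum-map-1 L)

Unique-∷∷ : ∀ {a} {A : Set a} {u w : A} {E : List A} →
  u ≢ w → u ∉ E → w ∉ E → Unique E → Unique (u ∷ w ∷ E)
Unique-∷∷ {E = E} u≢w u∉E w∉E unique =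
  (u≢w ∷ ¬Any⇒All¬ E u∉E) ∷ ¬Any⇒All¬ E w∉E ∷ unique

-- Closed vertex sets and matchings

module _ {K : ℕ} (G : Graph K) where

  Adj-sym : ∀ {u v} → Adj G u v → Adj G v u
  Adj-sym {u} {v} uv = trans (sym (Graph.sym G u v)) uv

  Adj⇒≢ : ∀ {u v} → Adj G u v → u ≢ v
  Adj⇒≢ {u} uu refl with () ← trans (sym uu) (Graph.irrefl G u)

  Reachable-trans : ∀ {u v w} → Reachable G u v → Reachable G v w → Reachable G u w
  Reachable-trans here v↝w = v↝w
  Reachable-trans (step uu′ u′↝v) v↝w = step uu′ (Reachable-trans u′↝v v↝w)

  Reachable-sym : ∀ {u v} → Reachable G u v → Reachable G v u
  Reachable-sym here = here
  Reachable-sym (step uu′ u′↝v) =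
    Reachable-trans (Reachable-sym u′↝v) (step (Adj-sym uu′) here)

  Closed : (Fin K → Bool) → Set
  Closed S = ∀ {u v} → Adj G u v → S u ≡ true → S v ≡ true

  EdgeIn : (Fin K → Bool) → Fin K × Fin K → Set
  EdgeIn S (u , v) = Adj G u v × S u ≡ true × S v ≡ true

  MatchingIn : (Fin K → Bool) → List (Fin K × Fin K) → Set
  MatchingIn S M = All (EdgeIn S) M × Unique (endpoints G M)

  size : (Fin K → Bool) → ℕ
  size S = ∑ (λ v → S v ⊙ 1)

  vol : (Fin K → Bool) → ℕ
  vol S = ∑ (λ v → S v ⊙ degree G v)

  degree≡∑ : ∀ v → degree G v ≡ ∑ (λ u → Graph.adj G v u ⊙ 1)
  degree≡∑ v = ∑-allFin (λ u → Graph.adj G v u ⊙ 1)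

  endpoints-++ : ∀ M N → endpoints G (M ++ N) ≡ endpoints G M ++ endpoints G N
  endpoints-++ [] N = refl
  endpoints-++ ((u , v) ∷ M) N = cong (λ E → u ∷ v ∷ E) (endpoints-++ M N)

  length-endpoints : ∀ M → length (endpoints G M) ≡ length M + length M
  length-endpoints [] = refl
  length-endpoints (_ ∷ M) = cong suc (trans (cong suc (length-endpoints M)) (sym (+-suc _ _)))

  endpoint-in : ∀ {S M v} → All (EdgeIn S) M → v ∈ endpoints G M → S v ≡ true
  endpoint-in ((_ , inU , _) ∷ _) (here refl) = inU
  endpoint-in ((_ , _ , inV) ∷ _) (there (here refl)) = inV
  endpoint-in (_ ∷ edges) (there (there v∈E)) = endpoint-in edges v∈E

  endpoints-augment : ∀ as bs {x y u w} →
    endpoints G ((u , x) ∷ (w , y) ∷ as ++ bs) ↭ u ∷ w ∷ endpoints G (as ++ (x , y) ∷ bs)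
  endpoints-augment as bs {x} {y} {u} {w}
    rewrite endpoints-++ as bs | endpoints-++ as ((x , y) ∷ bs) =
    ↭-prep u (↭-trans (↭-swap x w ↭-refl)
                      (↭-prep w (↭-sym (shifts (endpoints G as) (x ∷ y ∷ [])))))

-- Connected components

module Components {K : ℕ} (G : Graph K) where
  open Graph G using (adj)

  record Labelling : Set where
    field
      label : Fin K → Fin K
      reaches : ∀ w → Reachable G (label w) w
      idempotent : ∀ w → label (label w) ≡ label w

  open Labelling

  roots : Labelling → ℕ
  roots L = ∑ (λ w → does (w ≟ label L w) ⊙ 1)

  Saturated : Labelling → Set
  Saturated L = ∀ {u v} → Adj G u v → label L u ≡ label L v

  discrete : Labelling
  discrete = record { label = λ w → w ; reaches = λ _ → here ; idempotent = λ _ → refl }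

  merge : (L : Labelling) {u v : Fin K} → Adj G u v → label L u ≢ label L v →
    Σ Labelling (λ L′ → roots L′ < roots L)
  merge L {u} {v} uv a≢b = L′ , ∑-mono-< b root-kept root-lost
    where
    a b : Fin K
    a = label L u
    b = label L v

    relabel : Fin K → Fin K
    relabel w = if does (label L w ≟ b) then a else label L w

    relabel-inside : ∀ {w} → label L w ≡ b → relabel w ≡ a
    relabel-inside {w} w∈b = cong (if_then a else label L w) (dec-true (label L w ≟ b) w∈b)

    relabel-outside : ∀ {w} → label L w ≢ b → relabel w ≡ label L w
    relabel-outside {w} w∉b = cong (if_then a else label L w) (dec-false (label L w ≟ b) w∉b)

    a-fixed : label L a ≡ a
    a-fixed = idempotent L u

    relabel-a : relabel a ≡ a
    relabel-a = trans (relabel-outside (λ a∈b → a≢b (trans (sym a-fixed) a∈b))) a-fixed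

    inside⇒≢a : ∀ {w} → label L w ≡ b → w ≢ a
    inside⇒≢a w∈b refl = a≢b (trans (sym a-fixed) w∈b)

    a↝b : Reachable G a b
    a↝b = Reachable-trans G (reaches L u) (step uv (Reachable-sym G (reaches L v)))

    reaches′ : ∀ w → Reachable G (relabel w) w
    reaches′ w with label L w ≟ b
    ... | yes w∈b =
      Reachable-trans G a↝b (subst (λ c → Reachable G c w) w∈b (reaches L w))
    ... | no w∉b = reaches L w

    idempotent′ : ∀ w → relabel (relabel w) ≡ relabel w
    idempotent′ w with label L w ≟ b
    ... | yes w∈b = relabel-a
    ... | no w∉b =
      trans (relabel-outside (λ ww∈b → w∉b (trans (sym (idempotent L w)) ww∈b)))
            (idempotent L w)

    L′ : Labelling
    L′ = record { label = relabel ; reaches = reaches′ ; idempotent = idempotent′ }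

    root-kept : ∀ w → does (w ≟ relabel w) ⊙ 1 ≤ does (w ≟ label L w) ⊙ 1
    root-kept w with label L w ≟ b
    ... | no w∉b = ≤-refl
    ... | yes w∈b rewrite dec-false (w ≟ a) (inside⇒≢a w∈b) = z≤n

    root-lost : does (b ≟ relabel b) ⊙ 1 < does (b ≟ label L b) ⊙ 1
    root-lost rewrite relabel-inside (idempotent L v) | dec-false (b ≟ a) (a≢b ∘ sym)
                    | idempotent L v | dec-true (b ≟ b) refl = s≤s z≤n

  saturate : (fuel : ℕ) (L : Labelling) → roots L < fuel → Σ Labelling Saturated
  saturate (suc fuel) L bound
    with any? (λ u → any? (λ v → (adj u v ≟ᵇ true) ×-dec ¬? (label L u ≟ label L v)))
  ... | yes (u , v , uv , a≢b) with L′ , fewer ← merge L uv a≢b =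
    saturate fuel L′ (<-≤-trans fewer (≤-pred bound))
  ... | no unsaturated = L , λ {u} {v} uv →
    decidable-stable (label L u ≟ label L v) (λ a≢b → unsaturated (u , v , uv , a≢b))

  componentLabelling : Σ Labelling Saturated
  componentLabelling = saturate (suc (roots discrete)) discrete ≤-refl

  labelling : Labelling
  labelling = proj₁ componentLabelling

  component : Fin K → Fin K → Bool
  component c v = does (c ≟ label labelling v)

  component-closed : ∀ c → Closed G (component c)
  component-closed c {u} {v} uv inU =
    dec-true (c ≟ label labelling v)
      (trans (dec-true⁻¹ (c ≟ label labelling u) inU) (proj₂ componentLabelling uv))

  component-reaches : ∀ {c v} → component c v ≡ true → Reachable G c v
  component-reaches {c} {v} inV =
    subst (λ r → Reachable G r v) (sym (dec-true⁻¹ (c ≟ label labelling v) inV))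
          (reaches labelling v)

  ∑-size : ∑ (λ c → size G (component c)) ≡ K
  ∑-size = begin
    ∑ (λ c → ∑ (λ v → component c v ⊙ 1))
      ≡⟨ ∑-swap (λ c v → component c v ⊙ 1) ⟩
    ∑ (λ v → ∑ (λ c → component c v ⊙ 1))
      ≡⟨ ∑-cong (λ v → ∑-select (label labelling v) (λ _ → 1)) ⟩
    ∑ {K} (λ _ → 1)
      ≡⟨ ∑-1 K ⟩
    K ∎
    where open ≡-Reasoning

  ∑-vol : ∑ (λ c → vol G (component c)) ≡ degreeSum G
  ∑-vol = begin
    ∑ (λ c → ∑ (λ v → component c v ⊙ degree G v))
      ≡⟨ ∑-swap (λ c v → component c v ⊙ degree G v) ⟩
    ∑ (λ v → ∑ (λ c → component c v ⊙ degree G v))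
      ≡⟨ ∑-cong (λ v → ∑-select (label labelling v) (λ _ → degree G v)) ⟩
    ∑ (degree G)
      ≡⟨ ∑-allFin (degree G) ⟨
    degreeSum G ∎
    where open ≡-Reasoning

  size≡0⇒vol≡0 : ∀ c → size G (component c) ≡ 0 → vol G (component c) ≡ 0
  size≡0⇒vol≡0 c empty = trans
    (∑-cong λ v →
      ⊙1≡0 (component c v) (degree G v) (∑≡0⇒≡0 (λ v → component c v ⊙ 1) empty v))
    (∑-zero K)

  component-connected : ∀ c {M} → MatchingIn G (component c) M → IsConnectedMatching G M
  component-connected c (edges , unique) =
    (All.map (λ { {u , v} (uv , _) → uv }) edges , unique) ,
    c , All.map (λ { {u , v} (_ , inU , inV) → component-reaches inU , component-reaches inV }) edges

  denseComponent : ∀ m → 0 < K → AvgDegreeAtLeast G m →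
    ∃[ c ] (0 < size G (component c) × m * size G (component c) ≤ vol G (component c))
  denseComponent m nonempty avgDegree = averaging m (vol G ∘ component) (size G ∘ component)
    size≡0⇒vol≡0
    (subst (0 <_) (sym ∑-size) nonempty)
    (subst₂ _≤_ (cong (m *_) (sym ∑-size)) (sym ∑-vol) avgDegree)

-- Degree counting against a locally maximal matching

module Exposed {K : ℕ} (G : Graph K) (S : Fin K → Bool) (M : List (Fin K × Fin K)) where
  open Graph G using (adj)

  matched : Fin K → Bool
  matched v = v ∈ᵇ endpoints G M

  exposed : Fin K → Bool
  exposed v = S v ∧ not (matched v)

  exposed⇒∈ : ∀ {v} → exposed v ≡ true → S v ≡ true
  exposed⇒∈ = proj₁ ∘ ∧-true

  exposed⇒∉ : ∀ {v} → exposed v ≡ true → v ∉ endpoints G M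
  exposed⇒∉ {v} _ with S v | matched v in matched-v
  ... | true | false = ∈ᵇ⇒∉ matched-v

  ExposedEdge : Set
  ExposedEdge = ∃[ u ] ∃[ w ] (exposed u ≡ true × exposed w ≡ true × Adj G u w)

  AugmentingAt : Fin K × Fin K → Set
  AugmentingAt (x , y) = ∃[ u ] ∃[ w ]
    (exposed u ≡ true × exposed w ≡ true × u ≢ w × Adj G x u × Adj G y w)

  exposedEdge? : Dec ExposedEdge
  exposedEdge? = any? λ u → any? λ w →
    (exposed u ≟ᵇ true) ×-dec (exposed w ≟ᵇ true) ×-dec (adj u w ≟ᵇ true)

  augmentingAt? : ∀ e → Dec (AugmentingAt e)
  augmentingAt? (x , y) = any? λ u → any? λ w →
    (exposed u ≟ᵇ true) ×-dec (exposed w ≟ᵇ true) ×-dec ¬? (u ≟ w) ×-dec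
    (adj x u ≟ᵇ true) ×-dec (adj y w ≟ᵇ true)

matching-arithmetic : ∀ {V A B N X} →
  V ≡ A + B + B → A + N ≤ N * N → B + B ≤ N * suc X → V ≤ N * (N + X)
matching-arithmetic {V} {A} {B} {N} {X} refl A+N≤N² 2B≤ =
  +-cancelʳ-≤ N V (N * (N + X)) (begin
  A + B + B + N
    ≡⟨ regroup A B N ⟩
  (A + N) + (B + B)
    ≤⟨ +-mono-≤ A+N≤N² 2B≤ ⟩
  N * N + N * suc X
    ≡⟨ expand N X ⟩
  N * (N + X) + N ∎)
  where
  open ≤-Reasoning
  regroup : ∀ A B N → A + B + B + N ≡ (A + N) + (B + B)
  regroup = solve-∀
  expand : ∀ N X → N * N + N * suc X ≡ N * (N + X) + N
  expand = solve-∀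

module Counting {K : ℕ} (G : Graph K) {S : Fin K → Bool} (closed : Closed G S)
                {M : List (Fin K × Fin K)} (matching : MatchingIn G S M) where
  open Graph G using (adj)
  open Exposed G S M

  N : ℕ
  N = length (endpoints G M)

  F : ℕ
  F = size G exposed

  ∑ᵐ : (Fin K → ℕ) → ℕ
  ∑ᵐ g = ∑ (λ v → matched v ⊙ g v)

  ∑ᵉ : (Fin K → ℕ) → ℕ
  ∑ᵉ g = ∑ (λ v → exposed v ⊙ g v)

  matchedNbrs : Fin K → ℕ
  matchedNbrs v = ∑ (λ u → matched u ⊙ adj v u ⊙ 1)

  exposedNbrs : Fin K → ℕ
  exposedNbrs v = ∑ (λ u → exposed u ⊙ adj v u ⊙ 1)

  matched⇒∈ : ∀ v → matched v ≡ true → S v ≡ true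
  matched⇒∈ v mᵥ = endpoint-in G (proj₁ matching) (∈ᵇ⇒∈ mᵥ)

  ∑ᵐ-endpoints : ∀ g → ∑ᵐ g ≡ sum (map g (endpoints G M))
  ∑ᵐ-endpoints g = ∑-∈ᵇ g (endpoints G M) (proj₂ matching)

  ∑ᵐ-1 : ∑ᵐ (λ _ → 1) ≡ N
  ∑ᵐ-1 = trans (∑ᵐ-endpoints (λ _ → 1)) (sum-map-1 (endpoints G M))

  size≡ : size G S ≡ N + F
  size≡ = begin
    ∑ (λ v → S v ⊙ 1)
      ≡⟨ ∑-cong (λ v → ⊙-split (S v) (matched v) 1 (matched⇒∈ v)) ⟩
    ∑ (λ v → matched v ⊙ 1 + exposed v ⊙ 1)
      ≡⟨ ∑-distrib-+ (λ v → matched v ⊙ 1) (λ v → exposed v ⊙ 1) ⟩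
    ∑ᵐ (λ _ → 1) + F
      ≡⟨ cong (_+ F) ∑ᵐ-1 ⟩
    N + F ∎
    where open ≡-Reasoning

  degree≡ : ∀ v → S v ≡ true → degree G v ≡ matchedNbrs v + exposedNbrs v
  degree≡ v inS = begin
    degree G v
      ≡⟨ degree≡∑ G v ⟩
    ∑ (λ u → adj v u ⊙ 1)
      ≡⟨ ∑-cong (λ u → ⊙-implied (adj v u) (S u) (λ vu → closed vu inS)) ⟩
    ∑ (λ u → S u ⊙ adj v u ⊙ 1)
      ≡⟨ ∑-cong (λ u → ⊙-split (S u) (matched u) (adj v u ⊙ 1) (matched⇒∈ u)) ⟩
    ∑ (λ u → matched u ⊙ adj v u ⊙ 1 + exposed u ⊙ adj v u ⊙ 1)
      ≡⟨ ∑-distrib-+ (λ u → matched u ⊙ adj v u ⊙ 1) (λ u → exposed u ⊙ adj v u ⊙ 1) ⟩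
    matchedNbrs v + exposedNbrs v ∎
    where open ≡-Reasoning

  matchedNbrs<N : ∀ v → matched v ≡ true → matchedNbrs v < N
  matchedNbrs<N v mᵥ = begin-strict
    matchedNbrs v
      <⟨ m<m+1 ⟩
    matchedNbrs v + ∑ (λ u → does (u ≟ v) ⊙ 1)
      ≡⟨ ∑-distrib-+ (λ u → matched u ⊙ adj v u ⊙ 1) (λ u → does (u ≟ v) ⊙ 1) ⟨
    ∑ (λ u → matched u ⊙ adj v u ⊙ 1 + does (u ≟ v) ⊙ 1)
      ≤⟨ ∑-mono-≤ neighbour-or-self ⟩
    ∑ᵐ (λ _ → 1)
      ≡⟨ ∑ᵐ-1 ⟩
    N ∎
    where
    open ≤-Reasoning
    m<m+1 : matchedNbrs v < matchedNbrs v + ∑ (λ u → does (u ≟ v) ⊙ 1)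
    m<m+1 rewrite ∑-select v (λ _ → 1) | +-comm (matchedNbrs v) 1 = ≤-refl
    neighbour-or-self : ∀ u → matched u ⊙ adj v u ⊙ 1 + does (u ≟ v) ⊙ 1 ≤ matched u ⊙ 1
    neighbour-or-self u with u ≟ v
    ... | yes refl rewrite mᵥ | Graph.irrefl G u = ≤-refl
    ... | no _ =
      ≤-trans (≤-reflexive (+-identityʳ _)) (⊙-mono (matched u) (λ _ → ⊙1≤1 (adj v u)))

  ∑ᵐ-matchedNbrs : ∑ᵐ matchedNbrs + N ≤ N * N
  ∑ᵐ-matchedNbrs = begin
    ∑ᵐ matchedNbrs + N
      ≡⟨ cong (∑ᵐ matchedNbrs +_) ∑ᵐ-1 ⟨
    ∑ᵐ matchedNbrs + ∑ᵐ (λ _ → 1)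
      ≡⟨ ∑-distrib-+ (λ v → matched v ⊙ matchedNbrs v) (λ v → matched v ⊙ 1) ⟨
    ∑ (λ v → matched v ⊙ matchedNbrs v + matched v ⊙ 1)
      ≡⟨ ∑-cong (λ v → ⊙-distrib-+ (matched v) (matchedNbrs v) 1) ⟨
    ∑ᵐ (λ v → matchedNbrs v + 1)
      ≤⟨ ∑-mono-≤ (λ v → ⊙-mono (matched v) (below v)) ⟩
    ∑ᵐ (λ _ → N)
      ≡⟨ ∑-cong (λ v → ⊙-* (matched v) N) ⟩
    ∑ (λ v → N * (matched v ⊙ 1))
      ≡⟨ ∑-distribˡ-* N (λ v → matched v ⊙ 1) ⟩
    N * ∑ᵐ (λ _ → 1)
      ≡⟨ cong (N *_) ∑ᵐ-1 ⟩
    N * N ∎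
    where
    open ≤-Reasoning
    below : ∀ v → matched v ≡ true → matchedNbrs v + 1 ≤ N
    below v mᵥ = ≤-trans (≤-reflexive (+-comm (matchedNbrs v) 1)) (matchedNbrs<N v mᵥ)

  module Maximal (noExposedEdge : ¬ ExposedEdge) (noAugmenting : All (¬_ ∘ AugmentingAt) M) where

    exposedNbrs-exposed : ∀ v → exposed v ≡ true → exposedNbrs v ≡ 0
    exposedNbrs-exposed v exp-v = trans (∑-cong none) (∑-zero K)
      where
      none : ∀ u → exposed u ⊙ adj v u ⊙ 1 ≡ 0
      none u with exposed u in exp-u | adj v u in vu
      ... | true | true = ⊥-elim (noExposedEdge (v , u , exp-v , exp-u , vu))
      ... | true | false = refl
      ... | false | _ = refl

    ∑ᵉ-matchedNbrs : ∑ᵉ matchedNbrs ≡ ∑ᵐ exposedNbrs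
    ∑ᵉ-matchedNbrs =
      ∑⊙∑-comm exposed matched (λ v u → adj v u ⊙ 1) (λ v u → cong (_⊙ 1) (Graph.sym G v u))

    degree-split : ∀ v → S v ⊙ degree G v ≡
      (matched v ⊙ matchedNbrs v + matched v ⊙ exposedNbrs v) + exposed v ⊙ matchedNbrs v
    degree-split v = trans (⊙-split (S v) (matched v) (degree G v) (matched⇒∈ v)) (cong₂ _+_
      (trans (⊙-cong (matched v) (degree≡ v ∘ matched⇒∈ v)) (⊙-distrib-+ (matched v) _ _))
      (⊙-cong (exposed v) λ exp-v → begin
        degree G v
          ≡⟨ degree≡ v (exposed⇒∈ exp-v) ⟩
        matchedNbrs v + exposedNbrs v
          ≡⟨ cong (matchedNbrs v +_) (exposedNbrs-exposed v exp-v) ⟩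
        matchedNbrs v + 0
          ≡⟨ +-identityʳ (matchedNbrs v) ⟩
        matchedNbrs v ∎))
      where open ≡-Reasoning

    vol≡ : vol G S ≡ ∑ᵐ matchedNbrs + ∑ᵐ exposedNbrs + ∑ᵐ exposedNbrs
    vol≡ = begin
      vol G S
        ≡⟨ ∑-cong degree-split ⟩
      ∑ (λ v → (matched v ⊙ matchedNbrs v + matched v ⊙ exposedNbrs v) + exposed v ⊙ matchedNbrs v)
        ≡⟨ ∑-distrib-+ (λ v → matched v ⊙ matchedNbrs v + matched v ⊙ exposedNbrs v)
                       (λ v → exposed v ⊙ matchedNbrs v) ⟩
      ∑ (λ v → matched v ⊙ matchedNbrs v + matched v ⊙ exposedNbrs v) + ∑ᵉ matchedNbrs
        ≡⟨ cong₂ _+_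
             (∑-distrib-+ (λ v → matched v ⊙ matchedNbrs v) (λ v → matched v ⊙ exposedNbrs v))
             ∑ᵉ-matchedNbrs ⟩
      ∑ᵐ matchedNbrs + ∑ᵐ exposedNbrs + ∑ᵐ exposedNbrs ∎
      where open ≡-Reasoning

    exposedNbrs-edge : ∀ {x y} → ¬ AugmentingAt (x , y) → exposedNbrs x + exposedNbrs y ≤ suc F
    exposedNbrs-edge {x} {y} ¬aug = ∑-crossing exposed (adj x) (adj y) λ u w exp-u exp-w xu yw →
      decidable-stable (u ≟ w) (λ u≢w → ¬aug (u , w , exp-u , exp-w , u≢w , xu , yw))

    exposedNbrs-endpoints : ∀ {M′} → All (¬_ ∘ AugmentingAt) M′ →
      sum (map exposedNbrs (endpoints G M′)) ≤ length M′ * suc F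
    exposedNbrs-endpoints [] = z≤n
    exposedNbrs-endpoints {(x , y) ∷ M′} (¬aug ∷ rest) = begin
      exposedNbrs x + (exposedNbrs y + sum (map exposedNbrs (endpoints G M′)))
        ≡⟨ +-assoc (exposedNbrs x) _ _ ⟨
      exposedNbrs x + exposedNbrs y + sum (map exposedNbrs (endpoints G M′))
        ≤⟨ +-mono-≤ (exposedNbrs-edge ¬aug) (exposedNbrs-endpoints rest) ⟩
      suc F + length M′ * suc F ∎
      where open ≤-Reasoning

    ∑ᵐ-exposedNbrs : ∑ᵐ exposedNbrs + ∑ᵐ exposedNbrs ≤ N * suc F
    ∑ᵐ-exposedNbrs rewrite ∑ᵐ-endpoints exposedNbrs | length-endpoints G M
                         | *-distribʳ-+ (suc F) (length M) (length M) =
      +-mono-≤ (exposedNbrs-endpoints noAugmenting) (exposedNbrs-endpoints noAugmenting)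

    vol-bound : vol G S ≤ N * size G S
    vol-bound rewrite size≡ =
      matching-arithmetic {N = N} {X = F} vol≡ ∑ᵐ-matchedNbrs ∑ᵐ-exposedNbrs

-- Growing a matching

module MatchingGrowth {K : ℕ} (G : Graph K) {S : Fin K → Bool} where
  open import Data.List.Relation.Binary.Permutation.Setoid.Properties (setoid (Fin K))
    using (Unique-resp-↭)

  Improvement : List (Fin K × Fin K) → Set
  Improvement M =
    ∃[ M′ ] (MatchingIn G S M′ × length (endpoints G M′) ≡ 2 + length (endpoints G M))

  augment : ∀ {M} as bs {x y} → M ≡ as ++ (x , y) ∷ bs → MatchingIn G S M →
    Exposed.AugmentingAt G S M (x , y) → Improvement M
  augment as bs {x} {y} refl (edges , unique) (u , w , exp-u , exp-w , u≢w , xu , yw) =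
    (u , x) ∷ (w , y) ∷ as ++ bs , (edges′ , unique′) , ↭-length permuted
    where
    open Exposed G S (as ++ (x , y) ∷ bs)

    permuted :
      endpoints G ((u , x) ∷ (w , y) ∷ as ++ bs) ↭ u ∷ w ∷ endpoints G (as ++ (x , y) ∷ bs)
    permuted = endpoints-augment G as bs

    unique′ : Unique (endpoints G ((u , x) ∷ (w , y) ∷ as ++ bs))
    unique′ = Unique-resp-↭ (↭⇒↭ₛ (↭-sym permuted))
      (Unique-∷∷ u≢w (exposed⇒∉ exp-u) (exposed⇒∉ exp-w) unique)

    edges′ : All (EdgeIn G S) ((u , x) ∷ (w , y) ∷ as ++ bs)
    edges′ with edgesₐ , (_ , inX , inY) ∷ edges_b ← ++⁻ as edges =
      (Adj-sym G xu , exposed⇒∈ exp-u , inX) ∷ (Adj-sym G yw , exposed⇒∈ exp-w , inY) ∷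
      ++⁺ edgesₐ edges_b

  module _ {M : List (Fin K × Fin K)} (matching : MatchingIn G S M) where
    open Exposed G S M

    extend : ExposedEdge → Improvement M
    extend (u , w , exp-u , exp-w , uw) =
      (u , w) ∷ M ,
      ( (uw , exposed⇒∈ exp-u , exposed⇒∈ exp-w) ∷ proj₁ matching
      , Unique-∷∷ (Adj⇒≢ G uw) (exposed⇒∉ exp-u) (exposed⇒∉ exp-w) (proj₂ matching)) ,
      refl

    improve : Improvement M ⊎ (¬ ExposedEdge × All (¬_ ∘ AugmentingAt) M)
    improve with exposedEdge?
    ... | yes edge = inj₁ (extend edge)
    ... | no noEdge with Any.any? augmentingAt? M
    ...   | no noAugmenting = inj₂ (noEdge , ¬Any⇒All¬ M noAugmenting)
    ...   | yes augmenting
      with (x , y) , xy∈M , augmentingAtXY ← find augmenting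
      with as , bs , M≡ ← ∈-∃++ xy∈M
      = inj₁ (augment as bs M≡ matching augmentingAtXY)

  largeMatching : ∀ {m} → Closed G S → 0 < size G S → m * size G S ≤ vol G S →
    ∃[ M ] (MatchingIn G S M × m ≤ length (endpoints G M))
  largeMatching {m} closed nonempty dense = grow m [] ([] , []) (m≤m+n m (m + 0))
    where
    two-more : ∀ n f → n + 2 * suc f ≡ 2 + n + 2 * f
    two-more = solve-∀

    grow : ∀ fuel M → MatchingIn G S M → m ≤ length (endpoints G M) + 2 * fuel →
      ∃[ M ] (MatchingIn G S M × m ≤ length (endpoints G M))
    grow fuel M matching bound with improve matching
    ... | inj₂ (noEdge , noAugmenting) =
      M , matching , *-cancelʳ-≤ m (length (endpoints G M)) (size G S) {{>-nonZero nonempty}}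
        (≤-trans dense (Counting.Maximal.vol-bound G closed matching noEdge noAugmenting))
    grow zero M matching bound | inj₁ _ =
      M , matching , ≤-trans bound (≤-reflexive (+-identityʳ _))
    grow (suc fuel) M matching bound | inj₁ (M′ , matching′ , longer) =
      grow fuel M′ matching′ (≤-trans bound (≤-reflexive
        (trans (two-more _ fuel) (cong (_+ 2 * fuel) (sym longer)))))

corollary6p10 : (K : ℕ) (G : Graph K) (m : ℕ) → 3 ≤ m → m ≤ K →
    AvgDegreeAtLeast G m →
    ∃[ M ] (IsConnectedMatching G M × m ≤ matchingVertices G M)
-- The hypotheses 3 ≤ m and m ≤ K only serve to rule out the empty graph.
corollary6p10 zero _ _ (s≤s _) ()
corollary6p10 (suc K) G m _ _ avgDegree =
  let c , nonempty , dense = denseComponent m (s≤s z≤n) avgDegree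
      M , matching , large = largeMatching G (component-closed c) nonempty dense
  in M , component-connected c matching , large
  where
  open Components G
  open MatchingGrowth using (largeMatching)
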